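{- Let $1\le m\le n$ and $0\le k\le n-1$ be integers. Then $|PF(m,n;k)|\le|LPF(m,n+k;k)|$, with equality only if $k=0$.
   Context: $PF(m,n;k)$ ($k$-Naples parking functions): tuples $(a_1,\dots,a_m)\in[n]^m$ of preferences of cars $c_1,\dots,c_m$ arriving in order on the directed path $1,\dots,n$, such that all cars park under the rule: car $c_j$ parks at $a_j$ if free; otherwise, if some vertex of $\{a_j-1,\dots,a_j-k\}\cap[n]$ is free it parks at the free one closest to $a_j$; otherwise it parks at the first free vertex after $a_j$ (failing if none). $LPF(m,n+k;k)$: tuples $(a_1,\dots,a_m)\in[n+k]^m$ such that, on the directed path $1,\dots,n+k$ whose first $k$ vertices $1,\dots,k$ are obstructed (unavailable for parking but may be preferred), all cars park under the classical rule: car $c_j$ parks at $a_j$ if it is free (unobstructed and unoccupied), otherwise at the first free vertex after $a_j$, failing if none. -}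

module Defs where

open import Data.Nat using (ℕ; zero; suc; _+_; _∸_; _<ᵇ_; _≡ᵇ_)
open import Data.Bool using (Bool; true; false; not; _∧_; _∨_; if_then_else_)
open import Data.List using (List; []; _∷_; map; concatMap; length)
open import Data.Bool.ListAction using (any)
open import Data.Maybe using (Maybe; just; nothing)
import Data.Maybe

-- Positions on the directed path are the naturals 1,…,N.
-- An occupancy state is the list of occupied positions.

occupied : List ℕ → ℕ → Bool
occupied occ v = any (λ u → u ≡ᵇ v) occ

firstFree : (ℕ → Bool) → (start cnt : ℕ) → Maybe ℕ
firstFree free start zero = nothing
firstFree free start (suc cnt) =
  if free start then just start else firstFree free (suc start) cnt

backFree : (ℕ → Bool) → (a : ℕ) → (d k : ℕ) → Maybe ℕ
backFree free a d zero = nothing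
backFree free a d (suc k) =
  if (d <ᵇ a) ∧ free (a ∸ d) then just (a ∸ d) else backFree free a (suc d) k

_orElse_ : {A : Set} → Maybe A → Maybe A → Maybe A
just x  orElse _ = just x
nothing orElse y = y

naplesFree : (n : ℕ) → List ℕ → ℕ → Bool
naplesFree n occ v = (0 <ᵇ v) ∧ (v <ᵇ suc n) ∧ not (occupied occ v)

naplesStep : (n k : ℕ) → List ℕ → ℕ → Maybe (List ℕ)
naplesStep n k occ a =
  if naplesFree n occ a then just (a ∷ occ)
  else Data.Maybe.map (_∷ occ)
         (backFree (naplesFree n occ) a 1 k orElse firstFree (naplesFree n occ) (suc a) (n ∸ a))

-- classical rule on the path 1,…,N whose first k vertices are obstructed
lotFree : (N k : ℕ) → List ℕ → ℕ → Bool
lotFree N k occ v = (k <ᵇ v) ∧ (v <ᵇ suc N) ∧ not (occupied occ v)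

lotStep : (N k : ℕ) → List ℕ → ℕ → Maybe (List ℕ)
lotStep N k occ a =
  if lotFree N k occ a then just (a ∷ occ)
  else Data.Maybe.map (_∷ occ) (firstFree (lotFree N k occ) (suc a) (N ∸ a))

runAll : (List ℕ → ℕ → Maybe (List ℕ)) → List ℕ → List ℕ → Bool
runAll step occ [] = true
runAll step occ (a ∷ as) with step occ a
... | just occ' = runAll step occ' as
... | nothing   = false

range1 : ℕ → List ℕ
range1 zero = []
range1 (suc n) = range1 n Data.List.++ (suc n ∷ [])

tuples : (m n : ℕ) → List (List ℕ)
tuples zero n = [] ∷ []
tuples (suc m) n = concatMap (λ a → map (a ∷_) (tuples m n)) (range1 n)

count : {A : Set} → (A → Bool) → List A → ℕ
count p [] = 0
count p (x ∷ xs) = if p x then suc (count p xs) else count p xs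

isNaplesPF : (n k : ℕ) → List ℕ → Bool
isNaplesPF n k = runAll (naplesStep n k) []

isLPF : (N k : ℕ) → List ℕ → Bool
isLPF N k = runAll (lotStep N k) []

#PF : (m n k : ℕ) → ℕ
#PF m n k = count (isNaplesPF n k) (tuples m n)

#LPF : (m N k : ℕ) → ℕ
#LPF m N k = count (isLPF N k) (tuples m N)

-- Run the k-Naples rule on the street [1, n] and the classical rule on the lot [1, n + k]
-- (first k spots obstructed) side by side on the same cars. A Naples car parks at most k spots
-- before its preference, and the invariant that every terminal window [s, n] of the street has no
-- more free spots than its translate [k + s, n + k] of the lot guarantees a free lot spot after the
-- preference; the invariant survives each step. So PF(m,n;k) ⊆ LPF(m,n+k;k) ∩ [n]^m. For k > 0 the
-- lot parking function (n + k, k + m − 1, …, k + 1) has an entry outside [n], so the inclusion is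
-- strict.

module Submission where

open import Defs
open import Data.Bool using (Bool; true; false; not; _∧_; _∨_; if_then_else_; T)
open import Data.Bool.Properties using (∧-conicalˡ; ∧-conicalʳ)
open import Data.Empty using (⊥-elim)
open import Data.List using (List; []; _∷_; [_]; map; concatMap; _++_; applyDownFrom)
open import Data.List.Properties using (++-assoc; ++-identityʳ; concatMap-++)
open import Data.List.Relation.Unary.Any using (here; there)
open import Data.List.Relation.Unary.All as All using (All; []; _∷_)
open import Data.List.Membership.Propositional using (_∈_; lose)
open import Data.List.Membership.Propositional.Properties using (∈-map⁺; ∈-++⁺ˡ; ∈-++⁺ʳ; ∈-concatMap⁺)
open import Data.Maybe using (just; nothing)
open import Data.Nat using (ℕ; zero; suc; _+_; _∸_; _≤_; _<_; z≤n; s≤s; z<s; _<ᵇ_; _≡ᵇ_; _≤?_; _<?_)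
open import Data.Nat.Properties
open import Data.Product using (_×_; _,_; ∃)
open import Data.Sum using (inj₁; inj₂)
open import Function using (_∘_)
open import Relation.Binary.PropositionalEquality hiding ([_])
open import Relation.Nullary using (yes; no)

T⇒≡true : ∀ {b} → T b → b ≡ true
T⇒≡true {true} _ = refl

≡true⇒≢false : ∀ {b} → b ≡ true → b ≢ false
≡true⇒≢false refl ()

<⇒<ᵇ≡true : ∀ {m n} → m < n → (m <ᵇ n) ≡ true
<⇒<ᵇ≡true = T⇒≡true ∘ <⇒<ᵇ

<ᵇ≡true⇒< : ∀ {m n} → (m <ᵇ n) ≡ true → m < n
<ᵇ≡true⇒< {m} {n} e = <ᵇ⇒< m n (subst T (sym e) _)

≡ᵇ-refl : ∀ n → (n ≡ᵇ n) ≡ true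
≡ᵇ-refl n = T⇒≡true (≡⇒≡ᵇ n n refl)

≡ᵇ≡true⇒≡ : ∀ {m n} → (m ≡ᵇ n) ≡ true → m ≡ n
≡ᵇ≡true⇒≡ {m} {n} e = ≡ᵇ⇒≡ m n (subst T (sym e) _)

≢⇒≡ᵇ≡false : ∀ {m n} → m ≢ n → (m ≡ᵇ n) ≡ false
≢⇒≡ᵇ≡false {m} {n} m≢n with m ≡ᵇ n in e
... | true  = ⊥-elim (m≢n (≡ᵇ≡true⇒≡ e))
... | false = refl

<ᵇ-+ˡ : ∀ k a b → (a <ᵇ b) ≡ (k + a <ᵇ k + b)
<ᵇ-+ˡ zero    a b = refl
<ᵇ-+ˡ (suc k) a b = <ᵇ-+ˡ k a b

∧-not-∨-split : ∀ b₁ b₂ b₃ b₄ → b₁ ∧ b₂ ∧ not (b₃ ∨ b₄) ≡ (b₁ ∧ b₂ ∧ not b₄) ∧ not b₃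
∧-not-∨-split false _     _     _     = refl
∧-not-∨-split true  false _     _     = refl
∧-not-∨-split true  true  true  true  = refl
∧-not-∨-split true  true  true  false = refl
∧-not-∨-split true  true  false true  = refl
∧-not-∨-split true  true  false false = refl

countFrom : (ℕ → Bool) → ℕ → ℕ → ℕ
countFrom f s zero    = 0
countFrom f s (suc d) = if f s then suc (countFrom f (suc s) d) else countFrom f (suc s) d

countFrom-+ : ∀ f s e d → countFrom f s (e + d) ≡ countFrom f s e + countFrom f (s + e) d
countFrom-+ f s zero    d = cong (λ t → countFrom f t d) (sym (+-identityʳ s))
countFrom-+ f s (suc e) d rewrite +-suc s e with f s
... | true  = cong suc (countFrom-+ f (suc s) e d)
... | false = countFrom-+ f (suc s) e d

countFrom-≡0 : ∀ f s d → (∀ u → s ≤ u → u < s + d → f u ≡ false) → countFrom f s d ≡ 0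
countFrom-≡0 f s zero    _     = refl
countFrom-≡0 f s (suc d) f-off rewrite f-off s ≤-refl (m<m+n s z<s) =
  countFrom-≡0 f (suc s) d (λ u s<u u<s+d → f-off u (<⇒≤ s<u) (subst (u <_) (sym (+-suc s d)) u<s+d))

countFrom-pos : ∀ f s d {u} → s ≤ u → u < s + d → f u ≡ true → 0 < countFrom f s d
countFrom-pos f s zero    s≤u u<s+0 _ = ⊥-elim (<⇒≱ (subst (_ <_) (+-identityʳ s) u<s+0) s≤u)
countFrom-pos f s (suc d) {u} s≤u u<s+d fu with f s in fs
... | true  = z<s
... | false = countFrom-pos f (suc s) d (≤∧≢⇒< s≤u s≢u) (subst (u <_) (+-suc s d) u<s+d) fu
  where
  s≢u : s ≢ u
  s≢u refl = ≡true⇒≢false fu fs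

countFrom-pos⁻ : ∀ f s d → 0 < countFrom f s d → ∃ λ u → s ≤ u × f u ≡ true
countFrom-pos⁻ f s (suc d) pos with f s in fs
... | true  = s , ≤-refl , fs
... | false with countFrom-pos⁻ f (suc s) d pos
...   | u , s<u , fu = u , <⇒≤ s<u , fu

countFrom-shift : ∀ f g k → (∀ u → f u ≡ g (k + u)) → ∀ s d → countFrom f s d ≡ countFrom g (k + s) d
countFrom-shift f g k f≗g s zero    = refl
countFrom-shift f g k f≗g s (suc d) rewrite f≗g s | sym (+-suc k s) with g (k + s)
... | true  = cong suc (countFrom-shift f g k f≗g (suc s) d)
... | false = countFrom-shift f g k f≗g (suc s) d

module Removal (f g : ℕ → Bool) (v : ℕ) (g≗f-v : ∀ u → g u ≡ f u ∧ not (v ≡ᵇ u)) where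

  countFrom-remove-< : ∀ s d → v < s → countFrom g s d ≡ countFrom f s d
  countFrom-remove-< s zero    _   = refl
  countFrom-remove-< s (suc d) v<s rewrite g≗f-v s | ≢⇒≡ᵇ≡false (<⇒≢ v<s) with f s
  ... | true  = cong suc (countFrom-remove-< (suc s) d (m≤n⇒m≤1+n v<s))
  ... | false = countFrom-remove-< (suc s) d (m≤n⇒m≤1+n v<s)

  countFrom-remove-≤ : ∀ s d → countFrom f s d ≤ suc (countFrom g s d)
  countFrom-remove-≤ s zero = z≤n
  countFrom-remove-≤ s (suc d) rewrite g≗f-v s with f s | v ≡ᵇ s in v≡ᵇs
  ... | true  | true  = s≤s (≤-reflexive (sym (countFrom-remove-< (suc s) d (s≤s (≤-reflexive (≡ᵇ≡true⇒≡ v≡ᵇs))))))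
  ... | true  | false = s≤s (countFrom-remove-≤ (suc s) d)
  ... | false | _     = countFrom-remove-≤ (suc s) d

  countFrom-remove-∈ : ∀ s d → s ≤ v → v < s + d → f v ≡ true → countFrom f s d ≡ suc (countFrom g s d)
  countFrom-remove-∈ s zero    s≤v v<s+0 _ = ⊥-elim (<⇒≱ (subst (v <_) (+-identityʳ s) v<s+0) s≤v)
  countFrom-remove-∈ s (suc d) s≤v v<s+d fv with m≤n⇒m<n∨m≡n s≤v
  ... | inj₂ refl rewrite g≗f-v s | ≡ᵇ-refl s | fv = cong suc (sym (countFrom-remove-< (suc s) d ≤-refl))
  ... | inj₁ s<v rewrite g≗f-v s | ≢⇒≡ᵇ≡false (>⇒≢ s<v) with f s
  ...   | true  = cong suc (countFrom-remove-∈ (suc s) d s<v (subst (v <_) (+-suc s d) v<s+d) fv)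
  ...   | false = countFrom-remove-∈ (suc s) d s<v (subst (v <_) (+-suc s d) v<s+d) fv

firstFree-sound : ∀ f s c {v} → firstFree f s c ≡ just v → f v ≡ true × s ≤ v
firstFree-sound f s (suc c) eq with f s in fs
firstFree-sound f s (suc c) refl | true = fs , ≤-refl
... | false with firstFree-sound f (suc s) c eq
...   | fv , s<v = fv , <⇒≤ s<v

firstFree-complete : ∀ f s c {u} → s ≤ u → u < s + c → f u ≡ true →
  ∃ λ q → firstFree f s c ≡ just q × (∀ w → s ≤ w → w < q → f w ≡ false)
firstFree-complete f s zero    s≤u u<s+0 _ = ⊥-elim (<⇒≱ (subst (_ <_) (+-identityʳ s) u<s+0) s≤u)
firstFree-complete f s (suc c) {u} s≤u u<s+c fu with f s in fs
... | true  = s , refl , λ w s≤w w<s → ⊥-elim (<⇒≱ w<s s≤w)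
... | false with firstFree-complete f (suc s) c (≤∧≢⇒< s≤u s≢u) (subst (u <_) (+-suc s c) u<s+c) fu
  where
  s≢u : s ≢ u
  s≢u refl = ≡true⇒≢false fu fs
...   | q , found , gap = q , found , gap′
  where
  gap′ : ∀ w → s ≤ w → w < q → f w ≡ false
  gap′ w s≤w w<q with m≤n⇒m<n∨m≡n s≤w
  ... | inj₁ s<w  = gap w s<w w<q
  ... | inj₂ refl = fs

backFree-sound : ∀ f a d k {v} → backFree f a (suc d) k ≡ just v → f v ≡ true × a ∸ (d + k) ≤ v
backFree-sound f a d (suc k) {v} eq with (suc d <ᵇ a) ∧ f (a ∸ suc d) in found
backFree-sound f a d (suc k) refl | true =
  ∧-conicalʳ _ _ found , ∸-monoʳ-≤ a (subst (suc d ≤_) (sym (+-suc d k)) (s≤s (m≤m+n d k)))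
... | false with backFree-sound f a (suc d) k eq
...   | fv , bound = fv , subst (λ t → a ∸ t ≤ v) (sym (+-suc d k)) bound

module Simulation (n k : ℕ) where

  NFree LFree : List ℕ → ℕ → Bool
  NFree = naplesFree n
  LFree = lotFree (n + k) k

  -- X and Y are the occupied spots of street and lot; s + d ≡ suc n makes [s, s + d) the terminal window [s, n].
  Dominated : List ℕ → List ℕ → Set
  Dominated X Y = ∀ s d → s + d ≡ suc n → countFrom (NFree X) s d ≤ countFrom (LFree Y) (k + s) d

  NFree-∷ : ∀ X v u → NFree (v ∷ X) u ≡ NFree X u ∧ not (v ≡ᵇ u)
  NFree-∷ X v u = ∧-not-∨-split (0 <ᵇ u) (u <ᵇ suc n) (v ≡ᵇ u) (occupied X u)

  LFree-∷ : ∀ Y q u → LFree (q ∷ Y) u ≡ LFree Y u ∧ not (q ≡ᵇ u)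
  LFree-∷ Y q u = ∧-not-∨-split (k <ᵇ u) (u <ᵇ suc (n + k)) (q ≡ᵇ u) (occupied Y u)

  NFree⇒≤ : ∀ X v → NFree X v ≡ true → v ≤ n
  NFree⇒≤ X v free = ≤-pred (<ᵇ≡true⇒< (∧-conicalˡ _ _ (∧-conicalʳ (0 <ᵇ v) _ free)))

  LFree⇒≤ : ∀ Y u → LFree Y u ≡ true → u ≤ n + k
  LFree⇒≤ Y u free = ≤-pred (<ᵇ≡true⇒< (∧-conicalˡ _ _ (∧-conicalʳ (k <ᵇ u) _ free)))

  naplesStep-parks : ∀ X a {X′} → naplesStep n k X a ≡ just X′ →
    ∃ λ v → X′ ≡ v ∷ X × NFree X v ≡ true × a ∸ k ≤ v
  naplesStep-parks X a eq with NFree X a in a-free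
  naplesStep-parks X a refl | true = a , refl , a-free , m∸n≤m a k
  ... | false with backFree (NFree X) a 1 k in back
  naplesStep-parks X a refl | false | just v = v , refl , backFree-sound (NFree X) a 0 k back
  ... | nothing with firstFree (NFree X) (suc a) (n ∸ a) in forward
  naplesStep-parks X a refl | false | nothing | just v with firstFree-sound (NFree X) (suc a) (n ∸ a) forward
  ... | v-free , a<v = v , refl , v-free , ≤-trans (m∸n≤m a k) (<⇒≤ a<v)

  lotStep-parks : ∀ Y a {u} → a ≤ u → LFree Y u ≡ true →
    ∃ λ q → lotStep (n + k) k Y a ≡ just (q ∷ Y) × (∀ w → a ≤ w → w < q → LFree Y w ≡ false)
  lotStep-parks Y a {u} a≤u u-free with LFree Y a in a-free
  ... | true  = a , refl , λ w a≤w w<a → ⊥-elim (<⇒≱ w<a a≤w)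
  ... | false with firstFree-complete (LFree Y) (suc a) (n + k ∸ a) (≤∧≢⇒< a≤u a≢u) u<end u-free
    where
    a≢u : a ≢ u
    a≢u refl = ≡true⇒≢false u-free a-free
    u<end : u < suc a + (n + k ∸ a)
    u<end = s≤s (subst (u ≤_) (sym (m+[n∸m]≡n (≤-trans a≤u (LFree⇒≤ Y u u-free)))) (LFree⇒≤ Y u u-free))
  ...   | q , found , gap rewrite found = q , refl , gap′
    where
    gap′ : ∀ w → a ≤ w → w < q → LFree Y w ≡ false
    gap′ w a≤w w<q with m≤n⇒m<n∨m≡n a≤w
    ... | inj₁ a<w  = gap w a<w w<q
    ... | inj₂ refl = a-free

  free-translate : ∀ {X Y j v} → Dominated X Y → j ≤ v → NFree X v ≡ true → ∃ λ u → k + j ≤ u × LFree Y u ≡ true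
  free-translate {X} {Y} {j} {v} dom j≤v v-free =
    countFrom-pos⁻ (LFree Y) (k + j) d (≤-trans naples-pos (dom j d window))
    where
    v≤n : v ≤ n
    v≤n = NFree⇒≤ X v v-free
    d : ℕ
    d = suc n ∸ j
    window : j + d ≡ suc n
    window = m+[n∸m]≡n (≤-trans j≤v (m≤n⇒m≤1+n v≤n))
    naples-pos : 0 < countFrom (NFree X) j d
    naples-pos = countFrom-pos (NFree X) j d j≤v (subst (v <_) (sym window) (s≤s v≤n)) v-free

  module Step {X Y : List ℕ} {v q a : ℕ} (dom : Dominated X Y) (v-free : NFree X v ≡ true) (a∸k≤v : a ∸ k ≤ v)
              (gap : ∀ w → a ≤ w → w < q → LFree Y w ≡ false) where

    module N = Removal (NFree X) (NFree (v ∷ X)) v (NFree-∷ X v)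
    module L = Removal (LFree Y) (LFree (q ∷ Y)) q (LFree-∷ Y q)
    open ≤-Reasoning

    window-∋v : ∀ s d → s + d ≡ suc n → s ≤ v →
      countFrom (NFree (v ∷ X)) s d ≤ countFrom (LFree (q ∷ Y)) (k + s) d
    window-∋v s d window s≤v = ≤-pred (begin
      suc (countFrom (NFree (v ∷ X)) s d) ≡⟨ N.countFrom-remove-∈ s d s≤v v<s+d v-free ⟨
      countFrom (NFree X) s d             ≤⟨ dom s d window ⟩
      countFrom (LFree Y) (k + s) d       ≤⟨ L.countFrom-remove-≤ (k + s) d ⟩
      suc (countFrom (LFree (q ∷ Y)) (k + s) d) ∎)
      where
      v<s+d : v < s + d
      v<s+d = subst (v <_) (sym window) (s≤s (NFree⇒≤ X v v-free))

    window-∌v∌q : ∀ s d → s + d ≡ suc n → v < s → q < k + s →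
      countFrom (NFree (v ∷ X)) s d ≤ countFrom (LFree (q ∷ Y)) (k + s) d
    window-∌v∌q s d window v<s q<k+s = begin
      countFrom (NFree (v ∷ X)) s d       ≡⟨ N.countFrom-remove-< s d v<s ⟩
      countFrom (NFree X) s d             ≤⟨ dom s d window ⟩
      countFrom (LFree Y) (k + s) d       ≡⟨ L.countFrom-remove-< (k + s) d q<k+s ⟨
      countFrom (LFree (q ∷ Y)) (k + s) d ∎

    -- The window [a ∸ k, n] contains v, so it has one more free street spot than [s, n];
    -- the lot spots between its translate and q are all occupied, so the lot had a spot to spare.
    window-∌v∋q : ∀ s d → s + d ≡ suc n → v < s → k + s ≤ q →
      countFrom (NFree (v ∷ X)) s d ≤ countFrom (LFree (q ∷ Y)) (k + s) d
    window-∌v∋q s d window v<s k+s≤q = ≤-pred (begin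
      suc (nap′ s d)          ≡⟨ cong suc (N.countFrom-remove-< s d v<s) ⟩
      suc (nap s d)           ≤⟨ +-monoˡ-≤ (nap s d) skipped-pos ⟩
      nap j e + nap s d       ≡⟨ cong (λ t → nap j e + nap t d) j+e≡s ⟨
      nap j e + nap (j + e) d ≡⟨ countFrom-+ (NFree X) j e d ⟨
      nap j (e + d)           ≤⟨ dom j (e + d) window′ ⟩
      lot (k + j) (e + d)     ≡⟨ countFrom-+ (LFree Y) (k + j) e d ⟩
      lot (k + j) e + lot (k + j + e) d ≡⟨ cong₂ _+_ skipped-occupied (cong (λ t → lot t d) k+j+e≡k+s) ⟩
      lot (k + s) d           ≤⟨ L.countFrom-remove-≤ (k + s) d ⟩
      suc (lot′ (k + s) d)    ∎)
      where
      nap nap′ lot lot′ : ℕ → ℕ → ℕ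
      nap  = countFrom (NFree X)
      nap′ = countFrom (NFree (v ∷ X))
      lot  = countFrom (LFree Y)
      lot′ = countFrom (LFree (q ∷ Y))
      j e : ℕ
      j = a ∸ k
      e = s ∸ j
      j+e≡s : j + e ≡ s
      j+e≡s = m+[n∸m]≡n (≤-trans a∸k≤v (<⇒≤ v<s))
      k+j+e≡k+s : k + j + e ≡ k + s
      k+j+e≡k+s = trans (+-assoc k j e) (cong (k +_) j+e≡s)
      window′ : j + (e + d) ≡ suc n
      window′ = trans (sym (+-assoc j e d)) (trans (cong (_+ d) j+e≡s) window)
      skipped-pos : 0 < countFrom (NFree X) j e
      skipped-pos = countFrom-pos (NFree X) j e a∸k≤v (subst (v <_) (sym j+e≡s) v<s) v-free
      skipped-occupied : countFrom (LFree Y) (k + j) e ≡ 0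
      skipped-occupied = countFrom-≡0 (LFree Y) (k + j) e λ u k+j≤u u<k+j+e →
        gap u (≤-trans (m≤n+m∸n a k) k+j≤u) (<-≤-trans u<k+j+e (subst (_≤ q) (sym k+j+e≡k+s) k+s≤q))

    dominated : Dominated (v ∷ X) (q ∷ Y)
    dominated s d window with s ≤? v | q <? k + s
    ... | yes s≤v | _        = window-∋v s d window s≤v
    ... | no s≰v  | yes q<k+s = window-∌v∌q s d window (≰⇒> s≰v) q<k+s
    ... | no s≰v  | no q≮k+s  = window-∌v∋q s d window (≰⇒> s≰v) (≮⇒≥ q≮k+s)

  lot-parks : ∀ as {X Y} → Dominated X Y →
    runAll (naplesStep n k) X as ≡ true → runAll (lotStep (n + k) k) Y as ≡ true
  lot-parks []       _   _     = refl
  lot-parks (a ∷ as) {X} {Y} dom parks with naplesStep n k X a in nstep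
  ... | just _ with naplesStep-parks X a nstep
  ...   | v , refl , v-free , a∸k≤v with free-translate {X} {Y} dom a∸k≤v v-free
  ...     | u , k+[a∸k]≤u , u-free with lotStep-parks Y a (≤-trans (m≤n+m∸n a k) k+[a∸k]≤u) u-free
  ...       | q , lstep , gap rewrite lstep =
    lot-parks as (Step.dominated {X} {Y} dom v-free a∸k≤v gap) parks

  dominated-[] : Dominated [] []
  dominated-[] s d _ = ≤-reflexive (countFrom-shift (NFree []) (LFree []) k translate s d)
    where
    k+[1+n]≡1+[n+k] : k + suc n ≡ suc (n + k)
    k+[1+n]≡1+[n+k] = trans (+-suc k n) (cong suc (+-comm k n))
    translate : ∀ u → NFree [] u ≡ LFree [] (k + u)
    translate u = cong₂ _∧_ (trans (<ᵇ-+ˡ k 0 u) (cong (_<ᵇ k + u) (+-identityʳ k)))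
                            (cong (_∧ true) (trans (<ᵇ-+ˡ k u (suc n)) (cong (k + u <ᵇ_) k+[1+n]≡1+[n+k])))

  naplesPF⇒LPF : ∀ as → isNaplesPF n k as ≡ true → isLPF (n + k) k as ≡ true
  naplesPF⇒LPF as = lot-parks as dominated-[]

module _ {A : Set} where

  count-++ : ∀ (p : A → Bool) xs ys → count p (xs ++ ys) ≡ count p xs + count p ys
  count-++ p []       ys = refl
  count-++ p (x ∷ xs) ys with p x
  ... | true  = cong suc (count-++ p xs ys)
  ... | false = count-++ p xs ys

  count-map : ∀ {B : Set} (p : B → Bool) (g : A → B) xs → count p (map g xs) ≡ count (p ∘ g) xs
  count-map p g []       = refl
  count-map p g (x ∷ xs) with p (g x)
  ... | true  = cong suc (count-map p g xs)
  ... | false = count-map p g xs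

  count-mono : ∀ {p q : A → Bool} → (∀ x → p x ≡ true → q x ≡ true) → ∀ xs → count p xs ≤ count q xs
  count-mono         p⇒q []       = z≤n
  count-mono {p} {q} p⇒q (x ∷ xs) with p x in px
  ... | true rewrite p⇒q x px = s≤s (count-mono p⇒q xs)
  ... | false with q x
  ...   | true  = m≤n⇒m≤1+n (count-mono p⇒q xs)
  ...   | false = count-mono p⇒q xs

  count-∈ : ∀ (p : A → Bool) {x xs} → x ∈ xs → p x ≡ true → 0 < count p xs
  count-∈ p {xs = y ∷ _}  (here refl) px rewrite px = z<s
  count-∈ p {xs = y ∷ xs} (there x∈xs) px with p y
  ... | true  = z<s
  ... | false = count-∈ p x∈xs px

count-concatMap-++ : ∀ {A : Set} (P : List ℕ → Bool) (f : A → List (List ℕ)) xs ys →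
  count P (concatMap f (xs ++ ys)) ≡ count P (concatMap f xs) + count P (concatMap f ys)
count-concatMap-++ P f xs ys = trans (cong (count P) (concatMap-++ f xs ys)) (count-++ P (concatMap f xs) _)

count-concatMap-mono : ∀ {A : Set} (P : List ℕ → Bool) {f g : A → List (List ℕ)} → (∀ x → count P (f x) ≤ count P (g x)) →
  ∀ xs → count P (concatMap f xs) ≤ count P (concatMap g xs)
count-concatMap-mono P f≤g []       = z≤n
count-concatMap-mono P {f} {g} f≤g (x ∷ xs) =
  subst₂ _≤_ (sym (count-++ P (f x) _)) (sym (count-++ P (g x) _)) (+-mono-≤ (f≤g x) (count-concatMap-mono P f≤g xs))

range1-++ : ∀ {N M} → N ≤ M → ∃ λ ys → range1 M ≡ range1 N ++ ys
range1-++ {M = zero}  z≤n = [] , refl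
range1-++ {N} {suc M} N≤1+M with m≤n⇒m<n∨m≡n N≤1+M
... | inj₂ refl = [] , sym (++-identityʳ (range1 N))
... | inj₁ N<1+M with range1-++ (≤-pred N<1+M)
...   | ys , eq = ys ++ [ suc M ] , trans (cong (_++ [ suc M ]) eq) (++-assoc (range1 N) ys [ suc M ])

∈-range1 : ∀ {x N} → 0 < x → x ≤ N → x ∈ range1 N
∈-range1 {N = zero}  0<x x≤0 = ⊥-elim (<⇒≱ 0<x x≤0)
∈-range1 {N = suc N} 0<x x≤1+N with m≤n⇒m<n∨m≡n x≤1+N
... | inj₁ x<1+N = ∈-++⁺ˡ (∈-range1 0<x (≤-pred x<1+N))
... | inj₂ refl  = ∈-++⁺ʳ (range1 N) (here refl)

startingWith : ℕ → ℕ → ℕ → List (List ℕ)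
startingWith m N a = map (a ∷_) (tuples m N)

count-tuples-mono : ∀ m {N M} → N ≤ M → ∀ P → count P (tuples m N) ≤ count P (tuples m M)
count-startingWith-mono : ∀ m {N N′ M M′} → N ≤ N′ → M ≤ M′ → ∀ P →
  count P (concatMap (startingWith m M) (range1 N)) ≤ count P (concatMap (startingWith m M′) (range1 N′))

count-tuples-mono zero    _   _ = ≤-refl
count-tuples-mono (suc m) N≤M P = count-startingWith-mono m N≤M N≤M P

count-startingWith-mono m {N} {N′} {M} {M′} N≤N′ M≤M′ P with range1-++ N≤N′
... | ys , eq = begin
  count P (concatMap (startingWith m M) (range1 N))   ≤⟨ count-concatMap-mono P same-head (range1 N) ⟩
  count P (concatMap (startingWith m M′) (range1 N))  ≤⟨ m≤m+n _ _ ⟩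
  count P (concatMap (startingWith m M′) (range1 N)) + count P (concatMap (startingWith m M′) ys)
                                                      ≡⟨ count-concatMap-++ P (startingWith m M′) (range1 N) ys ⟨
  count P (concatMap (startingWith m M′) (range1 N ++ ys)) ≡⟨ cong (count P ∘ concatMap (startingWith m M′)) eq ⟨
  count P (concatMap (startingWith m M′) (range1 N′)) ∎
  where
  open ≤-Reasoning
  same-head : ∀ a → count P (startingWith m M a) ≤ count P (startingWith m M′ a)
  same-head a = subst₂ _≤_ (sym (count-map P (a ∷_) (tuples m M))) (sym (count-map P (a ∷_) (tuples m M′)))
                       (count-tuples-mono m M≤M′ (P ∘ (a ∷_)))

count-tuples-new-head : ∀ m {N M} → N < M → ∀ P {t} → t ∈ tuples m M → P (M ∷ t) ≡ true →
  count P (tuples (suc m) N) < count P (tuples (suc m) M)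
count-tuples-new-head m {N} {suc M} (s≤s N≤M) P t∈ Pt = begin-strict
  count P (tuples (suc m) N)                                       ≤⟨ count-startingWith-mono m N≤M (m≤n⇒m≤1+n N≤M) P ⟩
  count P (concatMap (startingWith m (suc M)) (range1 M))          <⟨ m<m+n _ (count-∈ P (∈-++⁺ˡ (∈-map⁺ (suc M ∷_) t∈)) Pt) ⟩
  count P (concatMap (startingWith m (suc M)) (range1 M)) + count P (concatMap (startingWith m (suc M)) [ suc M ])
                                                                   ≡⟨ count-concatMap-++ P (startingWith m (suc M)) (range1 M) [ suc M ] ⟨
  count P (tuples (suc m) (suc M))                                 ∎
  where open ≤-Reasoning

m+1+n≤o⇒m+n<o : ∀ m n {o} → m + suc n ≤ o → m + n < o
m+1+n≤o⇒m+n<o m n {o} = subst (_≤ o) (+-suc m n)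

applyDownFrom-∈-tuples : ∀ {N} b c → 0 < b → b + c ≤ suc N → applyDownFrom (b +_) c ∈ tuples c N
applyDownFrom-∈-tuples b zero    _   _       = here refl
applyDownFrom-∈-tuples {N} b (suc c) 0<b b+1+c≤1+N =
  ∈-concatMap⁺ (startingWith c N) (lose (∈-range1 (≤-trans 0<b (m≤m+n b c)) b+c≤N)
                     (∈-map⁺ ((b + c) ∷_) (applyDownFrom-∈-tuples b c 0<b (m≤n⇒m≤1+n b+c≤N))))
  where
  b+c≤N : b + c ≤ N
  b+c≤N = ≤-pred (m+1+n≤o⇒m+n<o b c b+1+c≤1+N)

occupied-< : ∀ x occ → All (x <_) occ → occupied occ x ≡ false
occupied-< x []      []           = refl
occupied-< x (u ∷ _) (x<u ∷ x<occ) rewrite ≢⇒≡ᵇ≡false (>⇒≢ x<u) = occupied-< x _ x<occ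

lotStep-free : ∀ N K occ a → lotFree N K occ a ≡ true → lotStep N K occ a ≡ just (a ∷ occ)
lotStep-free N K occ a free rewrite free = refl

lotFree-below : ∀ N K occ x → K < x → x < suc N → All (x <_) occ → lotFree N K occ x ≡ true
lotFree-below N K occ x K<x x<1+N x<occ
  rewrite <⇒<ᵇ≡true K<x | <⇒<ᵇ≡true x<1+N | occupied-< x occ x<occ = refl

lot-parks-descending : ∀ N K b c occ → K < b → b + c ≤ suc N → All (b + c ≤_) occ →
  runAll (lotStep N K) occ (applyDownFrom (b +_) c) ≡ true
lot-parks-descending N K b zero    occ _   _         _       = refl
lot-parks-descending N K b (suc c) occ K<b b+1+c≤1+N b+1+c≤occ
  rewrite lotStep-free N K occ (b + c)
            (lotFree-below N K occ (b + c) (≤-trans K<b (m≤m+n b c))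
              (m+1+n≤o⇒m+n<o b c b+1+c≤1+N) (All.map (m+1+n≤o⇒m+n<o b c) b+1+c≤occ)) =
  lot-parks-descending N K b c (b + c ∷ occ) K<b (<⇒≤ (below b+1+c≤1+N)) (≤-refl ∷ All.map (<⇒≤ ∘ below) b+1+c≤occ)
  where
  below : ∀ {u} → b + suc c ≤ u → b + c < u
  below = m+1+n≤o⇒m+n<o b c

lot-witness : ∀ N K m → K + m < N → isLPF N K (N ∷ applyDownFrom (suc K +_) m) ≡ true
lot-witness N K m K+m<N
  rewrite lotStep-free N K [] N (lotFree-below N K [] N (≤-<-trans (m≤m+n K m) K+m<N) (n<1+n N) []) =
  lot-parks-descending N K (suc K) m (N ∷ []) ≤-refl (s≤s (<⇒≤ K+m<N)) (K+m<N ∷ [])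

#PF≤count-LPF : ∀ m n k → #PF m n k ≤ count (isLPF (n + k) k) (tuples m n)
#PF≤count-LPF m n k = count-mono (Simulation.naplesPF⇒LPF n k) (tuples m n)

#PF≤#LPF : ∀ m n k → #PF m n k ≤ #LPF m (n + k) k
#PF≤#LPF m n k = ≤-trans (#PF≤count-LPF m n k) (count-tuples-mono m (m≤m+n n k) (isLPF (n + k) k))

#PF<#LPF : ∀ m n K → 0 < K → m < n → #PF (suc m) n K < #LPF (suc m) (n + K) K
#PF<#LPF m n K 0<K m<n = ≤-<-trans (#PF≤count-LPF (suc m) n K)
  (count-tuples-new-head m (m<m+n n 0<K) (isLPF (n + K) K)
    (applyDownFrom-∈-tuples (suc K) m z<s (s≤s (<⇒≤ K+m<n+K)))
    (lot-witness (n + K) K m K+m<n+K))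
  where
  K+m<n+K : K + m < n + K
  K+m<n+K = subst (_< n + K) (+-comm m K) (+-monoˡ-< K m<n)

#PF≡#LPF⇒k≡0 : ∀ m n k → m < n → #PF (suc m) n k ≡ #LPF (suc m) (n + k) k → k ≡ 0
#PF≡#LPF⇒k≡0 m n zero    _   _   = refl
#PF≡#LPF⇒k≡0 m n (suc k) m<n eq = ⊥-elim (<-irrefl eq (#PF<#LPF m n (suc k) z<s m<n))

corollary2 : (m n k : ℕ) → 1 ≤ m → m ≤ n → k ≤ n ∸ 1 →
    (#PF m n k ≤ #LPF m (n + k) k) × (#PF m n k ≡ #LPF m (n + k) k → k ≡ 0)
corollary2 (suc m) n k _ m<n _ = #PF≤#LPF (suc m) n k , #PF≡#LPF⇒k≡0 m n k m<n
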